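{- Let $(G,\sigma)$ be a signed graph. Then $$C_r(G,\sigma)=\min\{C(G,\pi)\colon (G,\sigma)\text{ and }(G,\pi)\text{ are switching equivalent}\}.$$
   Context: A signed graph $(G,\sigma)$ is a finite simple graph $G$ with a map $\sigma\colon E(G)\to\{+,-\}$ ($\{\pm\}$ viewed as a multiplicative group). Switching at $X\subseteq V(G)$ reverses the signs of all edges with exactly one end in $X$; $(G,\sigma)$ and $(G,\pi)$ are switching equivalent if one is obtained from the other by switching at some vertex set. Information dissemination process on $(G,\sigma)$: each vertex has a state in $\{A,-A,C,0\}$, initially all $0$. In step $i\geq 1$: choose a vertex $v_i$ of state $0$ (a placement vertex) and give it a state in $\{A,-A\}$ as specified below. Then, simultaneously for every vertex $v$ currently in state $0$, consider its neighbours $z$ currently in state $A$ or $-A$ (states after placing $v_i$, before this step's updates); each such $z$ sends $\sigma(vz)\cdot\mathrm{state}(z)$ (with $-(-A)=A$). If $v$ has no such neighbour it stays $0$; if all sent values are equal, $v$ takes that value; if two sent values differ, $v$ gets state $C$ (confused). Vertices with state $A$, $-A$ or $C$ keep their state. Repeat until no vertex has state $0$. The value of a run is the number of vertices of final state $C$. In the (non-relaxed) ID process each placement vertex receives state $A$, and the confusion number $C(G,\sigma)$ is the minimum value over all runs. In the relaxed (rID) process each placement vertex may receive $A$ or $-A$, and the relaxed confusion number $C_r(G,\sigma)$ is the minimum value over all such runs. -}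

module Defs where

open import Data.Nat using (ℕ; zero; suc; _+_; _≤_)
open import Data.Fin using (Fin; _≟_)
open import Data.Bool using (Bool; true; false; if_then_else_; _xor_)
open import Data.List using (List; foldr; allFin)
open import Data.Product using (Σ; _×_)
open import Data.Unit using (⊤)
open import Relation.Nullary using (¬_; does)
open import Relation.Binary.PropositionalEquality using (_≡_)

data Sign : Set where
  plus minus : Sign

_·_ : Sign → Sign → Sign
plus  · s     = s
minus · plus  = minus
minus · minus = plus

sameSign : Sign → Sign → Bool
sameSign plus  plus  = true
sameSign minus minus = true
sameSign _     _     = false

record Graph (n : ℕ) : Set where
  field
    adj        : Fin n → Fin n → Bool
    adj-sym    : ∀ u v → adj u v ≡ adj v u
    adj-irrefl : ∀ v → adj v v ≡ false
open Graph public

-- A signature: a symmetric sign assignment to pairs of vertices; only its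
-- values on edges of the graph are ever used.
record Signature (n : ℕ) : Set where
  field
    sgn     : Fin n → Fin n → Sign
    sgn-sym : ∀ u v → sgn u v ≡ sgn v u
open Signature public

switchSign : ∀ {n} → (Fin n → Bool) → Signature n → Fin n → Fin n → Sign
switchSign X σ u v = if X u xor X v then minus · sgn σ u v else sgn σ u v

SwitchingEquivalent : ∀ {n} → Graph n → Signature n → Signature n → Set
SwitchingEquivalent {n} G σ π =
  Σ (Fin n → Bool) λ X → ∀ u v → adj G u v ≡ true → sgn π u v ≡ switchSign X σ u v

-- Vertex states: act plus = A, act minus = -A, conf = C, blank = 0.
data St : Set where
  act   : Sign → St
  conf  : St
  blank : St

Config : ℕ → Set
Config n = Fin n → St

combine : St → Sign → St
combine blank   s = act s
combine (act t) s = if sameSign t s then act t else conf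
combine conf    s = conf

msgStep : ∀ {n} → Graph n → Signature n → Config n → Fin n → Fin n → St → St
msgStep G σ c v z acc with adj G v z | c z
... | true | act t = combine acc (sgn σ v z · t)
... | _    | _     = acc

receive : ∀ {n} → Graph n → Signature n → Config n → Fin n → St
receive {n} G σ c v = foldr (msgStep G σ c v) blank (allFin n)

update : ∀ {n} → Graph n → Signature n → Config n → Config n
update G σ c v with c v
... | blank = receive G σ c v
... | s     = s

place : ∀ {n} → Config n → Fin n → Sign → Config n
place c v a u = if does (u ≟ v) then act a else c u

countConf : ∀ {n} → Config n → ℕ
countConf {n} c = foldr (λ v k → isC (c v) + k) 0 (allFin n)
  where
  isC : St → ℕ
  isC conf = 1
  isC _    = 0

Allowed : Bool → Sign → Set
Allowed true  a = ⊤
Allowed false a = a ≡ plus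

data RunFrom {n : ℕ} (G : Graph n) (σ : Signature n) (r : Bool) : Config n → ℕ → Set where
  finish : ∀ {c} → (∀ v → ¬ c v ≡ blank) → RunFrom G σ r c (countConf c)
  step   : ∀ {c k} (v : Fin n) (a : Sign) → c v ≡ blank → Allowed r a →
           RunFrom G σ r (update G σ (place c v a)) k → RunFrom G σ r c k

initial : ∀ {n} → Config n
initial _ = blank

-- k is the value of some run of the ID process (r = false) / rID process (r = true).
Achievable : ∀ {n} → Bool → Graph n → Signature n → ℕ → Set
Achievable r G σ k = RunFrom G σ r initial k

MinOf : (ℕ → Set) → ℕ → Set
MinOf P m = P m × (∀ k → P k → m ≤ k)

IsConfusionNumber : ∀ {n} → Graph n → Signature n → ℕ → Set
IsConfusionNumber G σ = MinOf (Achievable false G σ)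

IsRelaxedConfusionNumber : ∀ {n} → Graph n → Signature n → ℕ → Set
IsRelaxedConfusionNumber G σ = MinOf (Achievable true G σ)

-- Switching at X while multiplying the state of every vertex of X by -1 commutes with each step
-- of the process: a message along uz picks up the factor ε_u ε_z from the switched signature and
-- ε_z from the sender's state, so the receiver u sees exactly its own factor ε_u; confusion is
-- untouched.  Hence an ID run on a switching π of σ is an rID run on σ placing -A on X, and an
-- rID run on σ is an ID run on the switching of σ at the vertices where it placed -A.  So the
-- values of rID runs on σ are exactly the values of ID runs over the switching class, and the
-- minimum of a union of subsets of ℕ is the minimum of their minima.
module Submission where

open import Defs
open import Data.Bool using (Bool; true; false; if_then_else_; _xor_)
open import Data.Bool.Properties using (xor-comm)
open import Data.Fin using (Fin; _≟_)
open import Data.List using (allFin)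
open import Data.List.Properties using (foldr-cong; foldr-fusion)
open import Data.Nat using (ℕ; _+_; _≤_; _≤?_)
open import Data.Nat.Induction using (<-rec)
open import Data.Nat.Properties using (≮⇒≥; ≤-trans; +-cancelʳ-≡)
open import Data.Product using (Σ; ∃; _×_; _,_)
open import Data.Unit using (⊤; tt)
open import Function.Bundles using (_⇔_; mk⇔; Equivalence)
open import Function.Properties.Equivalence using () renaming (trans to ⇔-trans)
open import Relation.Nullary using (¬_; does; yes; no)
open import Relation.Nullary.Decidable using (decidable-stable; dec-true)
open import Relation.Binary.PropositionalEquality
open ≡-Reasoning

toSign : Bool → Sign
toSign false = plus
toSign true  = minus

·-assoc : ∀ a b c → (a · b) · c ≡ a · (b · c)
·-assoc plus  b     c     = refl
·-assoc minus plus  c     = refl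
·-assoc minus minus plus  = refl
·-assoc minus minus minus = refl

·-cancelˡ : ∀ e s → e · (e · s) ≡ s
·-cancelˡ plus  s     = refl
·-cancelˡ minus plus  = refl
·-cancelˡ minus minus = refl

·-cancel-common : ∀ e s t → (e · s) · (e · t) ≡ s · t
·-cancel-common plus  s     t = refl
·-cancel-common minus plus  t = ·-cancelˡ minus t
·-cancel-common minus minus t = refl

switchSign-toSign : ∀ {n} (X : Fin n → Bool) (σ : Signature n) u v →
  switchSign X σ u v ≡ toSign (X u) · (toSign (X v) · sgn σ u v)
switchSign-toSign X σ u v with X u | X v
... | false | false = refl
... | false | true  = refl
... | true  | false = refl
... | true  | true  = sym (·-cancelˡ minus (sgn σ u v))

_⊙_ : Sign → St → St
ε ⊙ act a = act (ε · a)
ε ⊙ conf  = conf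
ε ⊙ blank = blank

combine-⊙ : ∀ ε acc s → combine (ε ⊙ acc) (ε · s) ≡ ε ⊙ combine acc s
combine-⊙ ε     blank       s     = refl
combine-⊙ ε     conf        s     = refl
combine-⊙ plus  (act a)     s     with sameSign a s
... | true  = refl
... | false = refl
combine-⊙ minus (act plus)  plus  = refl
combine-⊙ minus (act plus)  minus = refl
combine-⊙ minus (act minus) plus  = refl
combine-⊙ minus (act minus) minus = refl

⊙-blank : ∀ ε s → ε ⊙ s ≡ blank → s ≡ blank
⊙-blank ε blank _ = refl

-- The summand of countConf is local to its definition; countConf on a one-vertex configuration
-- recovers it, plus 0.
confusedCount : St → ℕ
confusedCount s = countConf {1} (λ _ → s)

countConf-cong : ∀ {n} {c c' : Config n} →
  (∀ u → confusedCount (c u) ≡ confusedCount (c' u)) → countConf c ≡ countConf c'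
countConf-cong {n} same =
  foldr-cong (λ v k → cong (_+ k) (+-cancelʳ-≡ 0 _ _ (same v))) refl (allFin n)

confusedCount-⊙ : ∀ ε s → confusedCount (ε ⊙ s) ≡ confusedCount s
confusedCount-⊙ ε (act a) = refl
confusedCount-⊙ ε conf    = refl
confusedCount-⊙ ε blank   = refl

¬MinOf⇒empty : (P : ℕ → Set) → ¬ ∃ (MinOf P) → ∀ k → ¬ P k
¬MinOf⇒empty P noMin = <-rec (λ k → ¬ P k) λ k below Pk →
  noMin (k , Pk , λ j Pj → ≮⇒≥ λ j<k → below j<k Pj)

¬¬-MinOf : ∀ {P : ℕ → Set} {k} → P k → ¬ ¬ ∃ (MinOf P)
¬¬-MinOf {P} {k} Pk noMin = ¬MinOf⇒empty P noMin k Pk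

MinOf-cong : ∀ {P Q : ℕ → Set} {m} → (∀ k → P k ⇔ Q k) → MinOf P m ⇔ MinOf Q m
MinOf-cong P⇔Q = mk⇔
  (λ (Pm , least) → to (P⇔Q _) Pm , λ k Qk → least k (from (P⇔Q k) Qk))
  (λ (Qm , least) → from (P⇔Q _) Qm , λ k Pk → least k (to (P⇔Q k) Pk))
  where open Equivalence

-- The minima of the members exist only up to double negation; m ≤ k is decidable, so that suffices.
MinOf-⋃ : ∀ {I : Set} (S : I → Set) (Q : I → ℕ → Set) {m} →
  MinOf (λ k → Σ I λ i → S i × Q i k) m ⇔ MinOf (λ k → Σ I λ i → S i × MinOf (Q i) k) m
MinOf-⋃ S Q {m} = mk⇔
  (λ ((i , Si , Qim) , least) →
     (i , Si , Qim , λ k Qik → least k (i , Si , Qik)) ,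
     λ k (j , Sj , Qjk , _) → least k (j , Sj , Qjk))
  (λ ((i , Si , Qim , _) , least) → (i , Si , Qim) , λ k (j , Sj , Qjk) →
     decidable-stable (m ≤? k) λ m≰k → ¬¬-MinOf Qjk λ (l , Qjl , leastʲ) →
       m≰k (≤-trans (least l (j , Sj , Qjl , leastʲ)) (leastʲ k Qjk)))

switch : ∀ {n} → (Fin n → Bool) → Signature n → Signature n
switch X σ = record { sgn = switchSign X σ ; sgn-sym = symmetric }
  where
  symmetric : ∀ u v → switchSign X σ u v ≡ switchSign X σ v u
  symmetric u v rewrite xor-comm (X u) (X v) | sgn-sym σ u v = refl

SwitchingEquivalent-sym : ∀ {n} {G : Graph n} {σ π : Signature n} →
  SwitchingEquivalent G σ π → SwitchingEquivalent G π σ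
SwitchingEquivalent-sym {G = G} {σ} {π} (X , π≡) = X , σ≡
  where
  σ≡ : ∀ u v → adj G u v ≡ true → sgn σ u v ≡ switchSign X π u v
  σ≡ u v uv rewrite π≡ u v uv with X u xor X v
  ... | false = refl
  ... | true  = sym (·-cancelˡ minus (sgn σ u v))

update-blank : ∀ {n} (G : Graph n) σ (c : Config n) u → update G σ c u ≡ blank → c u ≡ blank
update-blank G σ c u _ with c u
... | blank = refl

SwitchedPlacementsAllowed : ∀ {n} {G : Graph n} {σ r c k} →
  Bool → (Fin n → Bool) → RunFrom G σ r c k → Set
SwitchedPlacementsAllowed r X (finish _)       = ⊤
SwitchedPlacementsAllowed r X (step v a _ _ ρ) =
  Allowed r (toSign (X v) · a) × SwitchedPlacementsAllowed r X ρ

module Switching {n} (G : Graph n) (X : Fin n → Bool) {σ π : Signature n}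
                 (π≡ : ∀ u v → adj G u v ≡ true → sgn π u v ≡ switchSign X σ u v) where

  sign : Fin n → Sign
  sign u = toSign (X u)

  Switched : Config n → Config n → Set
  Switched c c' = ∀ u → c' u ≡ sign u ⊙ c u

  message-switch : ∀ u z t → adj G u z ≡ true →
    sgn π u z · (sign z · t) ≡ sign u · (sgn σ u z · t)
  message-switch u z t uz = begin
    sgn π u z · (sign z · t)
      ≡⟨ cong (_· (sign z · t)) (trans (π≡ u z uz) (switchSign-toSign X σ u z)) ⟩
    (sign u · (sign z · sgn σ u z)) · (sign z · t)
      ≡⟨ ·-assoc (sign u) _ _ ⟩
    sign u · ((sign z · sgn σ u z) · (sign z · t))
      ≡⟨ cong (sign u ·_) (·-cancel-common (sign z) _ t) ⟩
    sign u · (sgn σ u z · t) ∎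

  msgStep-switch : ∀ {c c'} → Switched c c' → ∀ u z acc →
    msgStep G π c' u z (sign u ⊙ acc) ≡ sign u ⊙ msgStep G σ c u z acc
  msgStep-switch {c} {c'} sw u z acc with adj G u z in uz | c z | c' z | sw z
  ... | false | _     | _ | refl = refl
  ... | true  | blank | _ | refl = refl
  ... | true  | conf  | _ | refl = refl
  ... | true  | act t | _ | refl rewrite message-switch u z t uz =
    combine-⊙ (sign u) acc (sgn σ u z · t)

  receive-switch : ∀ {c c'} → Switched c c' → ∀ u → receive G π c' u ≡ sign u ⊙ receive G σ c u
  receive-switch sw u =
    sym (foldr-fusion (sign u ⊙_) blank (λ z acc → sym (msgStep-switch sw u z acc)) (allFin n))

  update-switch : ∀ {c c'} → Switched c c' → Switched (update G σ c) (update G π c')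
  update-switch {c} {c'} sw u with c u | c' u | sw u
  ... | blank | _ | refl = receive-switch sw u
  ... | conf  | _ | refl = refl
  ... | act a | _ | refl = refl

  place-switch : ∀ {c c'} → Switched c c' → ∀ v a →
    Switched (place c v a) (place c' v (sign v · a))
  place-switch sw v a u with u ≟ v
  ... | yes refl = refl
  ... | no _     = sw u

  countConf-switch : ∀ {c c'} → Switched c c' → countConf c' ≡ countConf c
  countConf-switch sw =
    countConf-cong λ u → trans (cong confusedCount (sw u)) (confusedCount-⊙ (sign u) _)

  run-switch : ∀ {r r' c c' k} → Switched c c' → (ρ : RunFrom G σ r c k) →
    SwitchedPlacementsAllowed r' X ρ → RunFrom G π r' c' k
  run-switch {c = c} {c'} sw (finish full) _ =
    subst (RunFrom G π _ c') (countConf-switch sw)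
      (finish λ v c'v≡blank → full v (⊙-blank (sign v) (c v) (trans (sym (sw v)) c'v≡blank)))
  run-switch sw (step v a cv _ ρ) (allowed , rest) =
    step v (sign v · a) (trans (sw v) (cong (sign v ⊙_) cv)) allowed
      (run-switch (update-switch (place-switch sw v a)) ρ rest)

isMinus : Sign → Bool
isMinus plus  = false
isMinus minus = true

toSign-isMinus-· : ∀ a → toSign (isMinus a) · a ≡ plus
toSign-isMinus-· plus  = refl
toSign-isMinus-· minus = refl

minusPlacements : ∀ {n} {G : Graph n} {σ r c k} → RunFrom G σ r c k → Fin n → Bool
minusPlacements (finish _)       u = false
minusPlacements (step v a _ _ ρ) u = if does (u ≟ v) then isMinus a else minusPlacements ρ u

-- The invariant constrains X on 0-vertices only; it survives a step because placement vertices
-- are distinct: each is 0 when chosen and never 0 afterwards.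
minusPlacements-allowed : ∀ {n} {G : Graph n} {σ c k}
  (ρ : RunFrom G σ true c k) (X : Fin n → Bool) →
  (∀ u → c u ≡ blank → X u ≡ minusPlacements ρ u) → SwitchedPlacementsAllowed false X ρ
minusPlacements-allowed (finish _) X agree = tt
minusPlacements-allowed {G = G} {σ} {c} (step v a cv _ ρ) X agree =
  placed , minusPlacements-allowed ρ X agree'
  where
  placed : toSign (X v) · a ≡ plus
  placed rewrite agree v cv | dec-true (v ≟ v) refl = toSign-isMinus-· a
  agree' : ∀ u → update G σ (place c v a) u ≡ blank → X u ≡ minusPlacements ρ u
  agree' u blank' with u ≟ v | agree u | update-blank G σ (place c v a) u blank'
  ... | no _ | agreeᵤ | cu = agreeᵤ cu

relaxed-allowed : ∀ {n} {G : Graph n} {σ r c k}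
  (X : Fin n → Bool) (ρ : RunFrom G σ r c k) →
  SwitchedPlacementsAllowed true X ρ
relaxed-allowed X (finish _)       = tt
relaxed-allowed X (step _ _ _ _ ρ) = tt , relaxed-allowed X ρ

module _ {n} (G : Graph n) (σ : Signature n) where

  switchedRun⇒relaxedRun : ∀ {π k} →
    SwitchingEquivalent G σ π → Achievable false G π k → Achievable true G σ k
  switchedRun⇒relaxedRun {π} sw ρ with SwitchingEquivalent-sym {G = G} {σ} {π} sw
  ... | X , σ≡ = Switching.run-switch G X σ≡ (λ _ → refl) ρ (relaxed-allowed X ρ)

  relaxedRun⇒switchedRun : ∀ {k} (ρ : Achievable true G σ k) →
    Achievable false G (switch (minusPlacements ρ) σ) k
  relaxedRun⇒switchedRun ρ =
    Switching.run-switch G (minusPlacements ρ) (λ _ _ _ → refl) (λ _ → refl) ρ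
      (minusPlacements-allowed ρ (minusPlacements ρ) (λ _ _ → refl))

  achievable-relaxed⇔switched : ∀ k → Achievable true G σ k ⇔
    Σ (Signature n) λ π → SwitchingEquivalent G σ π × Achievable false G π k
  achievable-relaxed⇔switched k = mk⇔
    (λ ρ → switch (minusPlacements ρ) σ , (minusPlacements ρ , λ _ _ _ → refl) ,
           relaxedRun⇒switchedRun ρ)
    (λ (π , sw , ρ) → switchedRun⇒relaxedRun sw ρ)

theorem3p3 : ∀ {n : ℕ} (G : Graph n) (σ : Signature n) (m : ℕ) →
    IsRelaxedConfusionNumber G σ m ⇔
    MinOf (λ k → Σ (Signature n) λ π → SwitchingEquivalent G σ π × IsConfusionNumber G π k) m
theorem3p3 G σ m =
  ⇔-trans (MinOf-cong (achievable-relaxed⇔switched G σ))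
          (MinOf-⋃ (SwitchingEquivalent G σ) (Achievable false G))
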